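{- Let $v$ be a support vertex of a graph $G$ and let $G'$ be obtained from $G$ by adding a new vertex $v'$ and the edge $vv'$. Then $G$ is a DTDP-graph if and only if $G'$ is a DTDP-graph, and $G$ is a minimal DTDP-graph if and only if $G'$ is a minimal DTDP-graph.
   Context: Graphs may have multiple edges and multiple loops. For a vertex $v$ of $G$, $N_G(v)$ is the set of vertices adjacent to $v$ (if $v$ carries a loop then $v\in N_G(v)$). The degree of $v$ is the number of non-loop edges incident with $v$ plus twice the number of loops at $v$; a leaf is a vertex of degree 1 and its unique neighbour is a support vertex. A set $D\subseteq V_G$ is dominating if every vertex not in $D$ has a neighbour in $D$; $T\subseteq V_G$ is total dominating if every vertex of $G$ (including those in $T$) has a neighbour in $T$. A DT-pair is a pair $(D,T)$ of disjoint vertex sets with $D$ dominating and $T$ total dominating; $G$ is a DTDP-graph if it has a DT-pair. A connected graph $G$ is a minimal DTDP-graph if it is a DTDP-graph and no proper spanning subgraph of $G$ (same vertex set, proper subset of the edges and loops) is a DTDP-graph. -}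

module Defs where

open import Data.Nat using (ℕ; suc; _+_; _<_)
open import Data.Fin using (Fin; inject₁; fromℕ; _≟_)
open import Data.Fin.Subset using (Subset; _∈_; _∉_)
open import Data.List using (List; []; _∷_; map; length; _++_)
open import Data.Nat.ListAction using (sum)
open import Data.List.Membership.Propositional using () renaming (_∈_ to _∈ₗ_)
open import Data.List.Relation.Binary.Sublist.Propositional using (_⊆_)
open import Data.Product using (Σ; _×_; _,_; ∃-syntax)
open import Data.Sum using (_⊎_)
open import Relation.Nullary using (¬_; yes; no)
open import Relation.Binary.PropositionalEquality using (_≡_)
open import Relation.Binary.Construct.Closure.ReflexiveTransitive using (Star)

-- A finite multigraph (multiple edges and loops allowed) on vertex set Fin n.
-- Each list entry (u , w) is one (unordered) edge; (u , u) is a loop.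
record Graph (n : ℕ) : Set where
  constructor mkGraph
  field
    edges : List (Fin n × Fin n)
open Graph public

Adj : ∀ {n} → Graph n → Fin n → Fin n → Set
Adj G u w = ((u , w) ∈ₗ edges G) ⊎ ((w , u) ∈ₗ edges G)

edgeDeg : ∀ {n} → Fin n → Fin n × Fin n → ℕ
edgeDeg v (a , b) with a ≟ v | b ≟ v
... | yes _ | yes _ = 2
... | yes _ | no _  = 1
... | no _  | yes _ = 1
... | no _  | no _  = 0

deg : ∀ {n} → Graph n → Fin n → ℕ
deg G v = sum (map (edgeDeg v) (edges G))

Leaf : ∀ {n} → Graph n → Fin n → Set
Leaf G u = deg G u ≡ 1

Support : ∀ {n} → Graph n → Fin n → Set
Support G v = ∃[ u ] (Leaf G u × Adj G u v)

Dominating : ∀ {n} → Graph n → Subset n → Set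
Dominating G D = ∀ v → v ∉ D → ∃[ u ] (u ∈ D × Adj G v u)

TotalDominating : ∀ {n} → Graph n → Subset n → Set
TotalDominating G T = ∀ v → ∃[ u ] (u ∈ T × Adj G v u)

Disjoint : ∀ {n} → Subset n → Subset n → Set
Disjoint D T = ∀ v → v ∈ D → v ∉ T

DTPair : ∀ {n} → Graph n → Subset n → Subset n → Set
DTPair G D T = Disjoint D T × Dominating G D × TotalDominating G T

DTDP : ∀ {n} → Graph n → Set
DTDP {n} G = Σ (Subset n) λ D → Σ (Subset n) λ T → DTPair G D T

Connected : ∀ {n} → Graph n → Set
Connected G = ∀ u w → Star (Adj G) u w

ProperSpanning : ∀ {n} → Graph n → Graph n → Set
ProperSpanning H G = (edges H ⊆ edges G) × (length (edges H) < length (edges G))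

MinimalDTDP : ∀ {n} → Graph n → Set
MinimalDTDP G = Connected G × DTDP G × (∀ H → ProperSpanning H G → ¬ DTDP H)

-- G' : add a new vertex v' (= fromℕ n, the last vertex) and the edge v v'.
addPendant : ∀ {n} → Graph n → Fin n → Graph (suc n)
addPendant {n} G v =
  mkGraph (map (λ { (a , b) → (inject₁ a , inject₁ b) }) (edges G) ++ ((inject₁ v , fromℕ n) ∷ []))

module Submission where

-- If u is a leaf hanging at v, every total dominating set T of G contains v, so the new
-- leaf v′ can join D and be totally dominated by v. Conversely, in G′ the leaf v′ forces v
-- into T′ and hence v′ into D′; so only v can depend on v′, and only for domination, which
-- u supplies instead (u ∈ D′ because its sole neighbour v lies in T′). Minimality transfers
-- because a proper spanning subgraph of G′ either drops the pendant edge, isolating v′, or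
-- is the pendant extension of a proper spanning subgraph of G.

open import Defs
open import Data.Nat using (ℕ; suc; _+_; _≤_; _<_; z≤n; s≤s; s<s⁻¹)
open import Data.Nat.Properties using (≤-trans; m≤m+n; m≤n+m; +-mono-≤; +-comm; ≤-refl; ≤-reflexive; 1+n≰n)
open import Data.Nat.ListAction using (sum)
open import Data.Fin as Fin using (Fin; inject₁; fromℕ; _≟_)
open import Data.Fin.Properties using (inject₁-injective; fromℕ≢inject₁)
open import Data.Fin.Relation.Unary.Top using (view; ‵fromℕ; ‵inject₁; view-inject₁)
open import Data.Fin.Subset using (_∈_)
open import Data.Fin.Subset.Properties using (_∈?_)
open import Data.Vec as Vec using (Vec; _[_]=_; here; there; initLast)
open import Data.Vec.Properties using ([]=-injective)
open import Data.Bool using (true; false)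
open import Data.List using (List; []; _∷_; map; length; _++_; [_])
open import Data.List.Properties using (length-++; length-map)
open import Data.List.Relation.Unary.Any using (here; there)
open import Data.List.Membership.Propositional using () renaming (_∈_ to _∈ₗ_; _∉_ to _∉ₗ_)
open import Data.List.Membership.Propositional.Properties using (∈-map⁺; ∈-map⁻; ∈-++⁺ˡ; ∈-++⁺ʳ; ∈-++⁻)
import Data.List.Relation.Binary.Sublist.Propositional as Sublist
open Sublist using (_⊆_; ⊆-refl)
open import Data.List.Relation.Binary.Sublist.Propositional.Properties using (Any-resp-⊆; map⁺; ++⁺)
open import Data.Product using (_×_; _,_; proj₁; proj₂; ∃-syntax)
open import Data.Sum using (_⊎_; inj₁; inj₂; reduce)
open import Function using (_∘_)
open import Function.Bundles using (_⇔_; mk⇔)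
open import Relation.Nullary using (¬_; yes; no; contradiction)
open import Relation.Binary.PropositionalEquality
  using (_≡_; _≢_; refl; sym; trans; cong; subst; subst₂; module ≡-Reasoning)
open import Relation.Binary.Construct.Closure.ReflexiveTransitive using (Star; ε; _◅_; _◅◅_; gmap; reverse; kleisliStar)
open import Relation.Binary.Construct.Closure.ReflexiveTransitive.Properties using (reflexive)

∈⇒≤sum : ∀ {n ns} → n ∈ₗ ns → n ≤ sum ns
∈⇒≤sum {ns = m ∷ ns} (here refl) = m≤m+n m (sum ns)
∈⇒≤sum {ns = m ∷ ns} (there n∈ns) = ≤-trans (∈⇒≤sum n∈ns) (m≤n+m (sum ns) m)

positive-twice⇒sum>1 : ∀ {A : Set} (f : A → ℕ) {x y : A} {xs} →
  1 ≤ f x → 1 ≤ f y → y ∈ₗ xs → ¬ sum (map f (x ∷ xs)) ≤ 1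
positive-twice⇒sum>1 f 1≤fx 1≤fy y∈xs sum≤1 =
  1+n≰n (≤-trans (+-mono-≤ 1≤fx (≤-trans 1≤fy (∈⇒≤sum (∈-map⁺ f y∈xs)))) sum≤1)

sum-map≤1⇒positive-unique : ∀ {A : Set} (f : A → ℕ) {xs : List A} {x y} →
  sum (map f xs) ≤ 1 → x ∈ₗ xs → y ∈ₗ xs → 1 ≤ f x → 1 ≤ f y → x ≡ y
sum-map≤1⇒positive-unique f _ (here refl) (here refl) _ _ = refl
sum-map≤1⇒positive-unique f sum≤1 (here refl) (there y∈xs) 1≤fx 1≤fy =
  contradiction sum≤1 (positive-twice⇒sum>1 f 1≤fx 1≤fy y∈xs)
sum-map≤1⇒positive-unique f sum≤1 (there x∈xs) (here refl) 1≤fx 1≤fy =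
  contradiction sum≤1 (positive-twice⇒sum>1 f 1≤fy 1≤fx x∈xs)
sum-map≤1⇒positive-unique f {z ∷ xs} sum≤1 (there x∈xs) (there y∈xs) =
  sum-map≤1⇒positive-unique f (≤-trans (m≤n+m (sum (map f xs)) (f z)) sum≤1) x∈xs y∈xs

⊆-map⁻ : ∀ {A B : Set} (f : A → B) {xs : List A} {ys : List B} →
  ys ⊆ map f xs → ∃[ zs ] (zs ⊆ xs × ys ≡ map f zs)
⊆-map⁻ f {[]} Sublist.[] = [] , Sublist.[] , refl
⊆-map⁻ f {x ∷ xs} (_ Sublist.∷ʳ ys⊆) with ⊆-map⁻ f ys⊆
... | zs , zs⊆ , refl = zs , x Sublist.∷ʳ zs⊆ , refl
⊆-map⁻ f {x ∷ xs} (refl Sublist.∷ ys⊆) with ⊆-map⁻ f ys⊆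
... | zs , zs⊆ , refl = x ∷ zs , refl Sublist.∷ zs⊆ , refl

⊆-++-[]⁻ : ∀ {A : Set} (xs : List A) {x : A} {ys} →
  ys ⊆ xs ++ [ x ] → ys ⊆ xs ⊎ ∃[ zs ] (zs ⊆ xs × ys ≡ zs ++ [ x ])
⊆-++-[]⁻ [] (_ Sublist.∷ʳ Sublist.[]) = inj₁ Sublist.[]
⊆-++-[]⁻ [] (refl Sublist.∷ Sublist.[]) = inj₂ ([] , Sublist.[] , refl)
⊆-++-[]⁻ (y ∷ xs) (_ Sublist.∷ʳ ys⊆) with ⊆-++-[]⁻ xs ys⊆
... | inj₁ ys⊆xs = inj₁ (y Sublist.∷ʳ ys⊆xs)
... | inj₂ (zs , zs⊆ , refl) = inj₂ (zs , y Sublist.∷ʳ zs⊆ , refl)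
⊆-++-[]⁻ (y ∷ xs) (refl Sublist.∷ ys⊆) with ⊆-++-[]⁻ xs ys⊆
... | inj₁ ys⊆xs = inj₁ (refl Sublist.∷ ys⊆xs)
... | inj₂ (zs , zs⊆ , refl) = inj₂ (y ∷ zs , refl Sublist.∷ zs⊆ , refl)

∷ʳ-[]=⁺ : ∀ {A : Set} {n} {xs : Vec A n} {i x y} → xs [ i ]= x → (xs Vec.∷ʳ y) [ inject₁ i ]= x
∷ʳ-[]=⁺ here = here
∷ʳ-[]=⁺ (there xs[i]=x) = there (∷ʳ-[]=⁺ xs[i]=x)

∷ʳ-[]=⁻ : ∀ {A : Set} {n} (xs : Vec A n) {i x y} → (xs Vec.∷ʳ y) [ inject₁ i ]= x → xs [ i ]= x
∷ʳ-[]=⁻ (_ Vec.∷ _) {Fin.zero} here = here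
∷ʳ-[]=⁻ (_ Vec.∷ xs) {Fin.suc i} (there xs[i]=x) = there (∷ʳ-[]=⁻ xs xs[i]=x)

∷ʳ-[]=-fromℕ : ∀ {A : Set} {n} (xs : Vec A n) {y} → (xs Vec.∷ʳ y) [ fromℕ n ]= y
∷ʳ-[]=-fromℕ Vec.[] = here
∷ʳ-[]=-fromℕ (_ Vec.∷ xs) = there (∷ʳ-[]=-fromℕ xs)

edgeDeg-src : ∀ {n} (u a : Fin n) → 1 ≤ edgeDeg u (u , a)
edgeDeg-src u a with u ≟ u | a ≟ u
... | yes _ | yes _ = s≤s z≤n
... | yes _ | no _ = s≤s z≤n
... | no u≢u | _ = contradiction refl u≢u

edgeDeg-tgt : ∀ {n} (u a : Fin n) → 1 ≤ edgeDeg u (a , u)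
edgeDeg-tgt u a with a ≟ u | u ≟ u
... | yes _ | yes _ = s≤s z≤n
... | no _ | yes _ = s≤s z≤n
... | _ | no u≢u = contradiction refl u≢u

edgeDeg-loop : ∀ {n} (u : Fin n) → 2 ≤ edgeDeg u (u , u)
edgeDeg-loop u with u ≟ u
... | yes _ = ≤-refl
... | no u≢u = contradiction refl u≢u

edgeDeg≤deg : ∀ {n} (G : Graph n) {u e} → e ∈ₗ edges G → edgeDeg u e ≤ deg G u
edgeDeg≤deg G {u} = ∈⇒≤sum ∘ ∈-map⁺ (edgeDeg u)

Joins : ∀ {n} → Fin n × Fin n → Fin n → Fin n → Set
Joins e u a = e ≡ (u , a) ⊎ e ≡ (a , u)

Joins-unique : ∀ {n} {e : Fin n × Fin n} {u a b} → Joins e u a → Joins e u b → a ≡ b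
Joins-unique (inj₁ refl) (inj₁ refl) = refl
Joins-unique (inj₁ refl) (inj₂ refl) = refl
Joins-unique (inj₂ refl) (inj₁ refl) = refl
Joins-unique (inj₂ refl) (inj₂ refl) = refl

Adj⇒incidentEdge : ∀ {n} (G : Graph n) {u a} → Adj G u a →
  ∃[ e ] (e ∈ₗ edges G × 1 ≤ edgeDeg u e × Joins e u a)
Adj⇒incidentEdge G {u} {a} (inj₁ ua∈G) = _ , ua∈G , edgeDeg-src u a , inj₁ refl
Adj⇒incidentEdge G {u} {a} (inj₂ au∈G) = _ , au∈G , edgeDeg-tgt u a , inj₂ refl

Leaf⇒neighbour-unique : ∀ {n} (G : Graph n) {u a b} → Leaf G u → Adj G u a → Adj G u b → a ≡ b
Leaf⇒neighbour-unique G {u} leaf u~a u~b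
  with _ , e∈G , 1≤e , e-ua ← Adj⇒incidentEdge G u~a
     | _ , f∈G , 1≤f , f-ub ← Adj⇒incidentEdge G u~b
  with refl ← sum-map≤1⇒positive-unique (edgeDeg u) (≤-reflexive leaf) e∈G f∈G 1≤e 1≤f =
  Joins-unique e-ua f-ub

Leaf⇒loopless : ∀ {n} (G : Graph n) {u} → Leaf G u → ¬ Adj G u u
Leaf⇒loopless G {u} leaf u~u =
  1+n≰n (≤-trans (edgeDeg-loop u) (subst (_ ≤_) leaf (edgeDeg≤deg G (reduce u~u))))

-- Unlike Leaf, this is inherited by spanning subgraphs.
AdjOnlyTo : ∀ {n} → Graph n → Fin n → Fin n → Set
AdjOnlyTo G u v = (∀ {w} → Adj G u w → w ≡ v) × u ≢ v

Support⇒AdjOnlyTo : ∀ {n} (G : Graph n) {v} → Support G v → ∃[ u ] AdjOnlyTo G u v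
Support⇒AdjOnlyTo G (u , leaf , u~v) =
  u , (λ u~w → Leaf⇒neighbour-unique G leaf u~w u~v) , λ { refl → Leaf⇒loopless G leaf u~v }

Adj-sym : ∀ {n} (G : Graph n) {a b} → Adj G a b → Adj G b a
Adj-sym G (inj₁ ab∈G) = inj₂ ab∈G
Adj-sym G (inj₂ ba∈G) = inj₁ ba∈G

Adj-⊆ : ∀ {n} {H G : Graph n} → edges H ⊆ edges G → ∀ {a b} → Adj H a b → Adj G a b
Adj-⊆ H⊆G (inj₁ ab∈H) = inj₁ (Any-resp-⊆ H⊆G ab∈H)
Adj-⊆ H⊆G (inj₂ ba∈H) = inj₂ (Any-resp-⊆ H⊆G ba∈H)

AdjOnlyTo-⊆ : ∀ {n} {H G : Graph n} → edges H ⊆ edges G →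
  ∀ {u v} → AdjOnlyTo G u v → AdjOnlyTo H u v
AdjOnlyTo-⊆ H⊆G (only , u≢v) = only ∘ Adj-⊆ H⊆G , u≢v

AdjOnlyTo⇒dominated : ∀ {n} {G : Graph n} {u v T} → AdjOnlyTo G u v →
  TotalDominating G T → v ∈ T × Adj G u v
AdjOnlyTo⇒dominated {u = u} (only , _) td with x , x∈T , u~x ← td u with refl ← only u~x =
  x∈T , u~x

AdjOnlyTo⇒∈D : ∀ {n} {G : Graph n} {u v D T} → AdjOnlyTo G u v → DTPair G D T → u ∈ D
AdjOnlyTo⇒∈D {u = u} {D = D} only@(adj-only , _) (dis , dom , td) with u ∈? D
... | yes u∈D = u∈D
... | no u∉D with x , x∈D , u~x ← dom u u∉D with refl ← adj-only u~x =
  contradiction (proj₁ (AdjOnlyTo⇒dominated only td)) (dis x x∈D)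

liftEdge : ∀ {n} → Fin n × Fin n → Fin (suc n) × Fin (suc n)
liftEdge (a , b) = inject₁ a , inject₁ b

∈-map-liftEdge⁻ : ∀ {n} {L : List (Fin n × Fin n)} {a b} →
  (inject₁ a , inject₁ b) ∈ₗ map liftEdge L → (a , b) ∈ₗ L
∈-map-liftEdge⁻ ab∈L′ with (a′ , b′) , a′b′∈L , eq ← ∈-map⁻ liftEdge ab∈L′
  with refl ← inject₁-injective (cong proj₁ eq) | refl ← inject₁-injective (cong proj₂ eq) = a′b′∈L

fromℕ-src∉map-liftEdge : ∀ {n} {L : List (Fin n × Fin n)} {y} → (fromℕ n , y) ∉ₗ map liftEdge L
fromℕ-src∉map-liftEdge e∈L′ with _ , _ , eq ← ∈-map⁻ liftEdge e∈L′ = fromℕ≢inject₁ (cong proj₁ eq)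

fromℕ-tgt∉map-liftEdge : ∀ {n} {L : List (Fin n × Fin n)} {x} → (x , fromℕ n) ∉ₗ map liftEdge L
fromℕ-tgt∉map-liftEdge e∈L′ with _ , _ , eq ← ∈-map⁻ liftEdge e∈L′ = fromℕ≢inject₁ (cong proj₂ eq)

length-addPendant : ∀ {n} (G : Graph n) v → length (edges (addPendant G v)) ≡ suc (length (edges G))
length-addPendant G v = begin
  length (map liftEdge (edges G) ++ [ inject₁ v , fromℕ _ ]) ≡⟨ length-++ (map liftEdge (edges G)) ⟩
  length (map liftEdge (edges G)) + 1                        ≡⟨ cong (_+ 1) (length-map liftEdge (edges G)) ⟩
  length (edges G) + 1                                       ≡⟨ +-comm (length (edges G)) 1 ⟩
  suc (length (edges G))                                     ∎
  where open ≡-Reasoning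

ProperSpanning-addPendant : ∀ {n} {H G : Graph n} v →
  ProperSpanning H G → ProperSpanning (addPendant H v) (addPendant G v)
ProperSpanning-addPendant {H = H} {G} v (H⊆G , shorter) =
  ++⁺ (map⁺ liftEdge H⊆G) ⊆-refl ,
  subst₂ _<_ (sym (length-addPendant H v)) (sym (length-addPendant G v)) (s≤s shorter)

module Pendant {n} (G : Graph n) (v : Fin n) where

  G′ : Graph (suc n)
  G′ = addPendant G v

  new : Fin (suc n)
  new = fromℕ n

  Adj-lift⁺ : ∀ {a b} → Adj G a b → Adj G′ (inject₁ a) (inject₁ b)
  Adj-lift⁺ (inj₁ ab∈G) = inj₁ (∈-++⁺ˡ (∈-map⁺ liftEdge ab∈G))
  Adj-lift⁺ (inj₂ ba∈G) = inj₂ (∈-++⁺ˡ (∈-map⁺ liftEdge ba∈G))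

  Adj-pendant : Adj G′ (inject₁ v) new
  Adj-pendant = inj₁ (∈-++⁺ʳ (map liftEdge (edges G)) (here refl))

  ∈-lift⁻ : ∀ {a b} → (inject₁ a , inject₁ b) ∈ₗ edges G′ → (a , b) ∈ₗ edges G
  ∈-lift⁻ ab∈G′ with ∈-++⁻ (map liftEdge (edges G)) ab∈G′
  ... | inj₁ ab∈L′ = ∈-map-liftEdge⁻ ab∈L′
  ... | inj₂ (here eq) = contradiction (sym (cong proj₂ eq)) fromℕ≢inject₁

  Adj-lift⁻ : ∀ {a b} → Adj G′ (inject₁ a) (inject₁ b) → Adj G a b
  Adj-lift⁻ (inj₁ ab∈G′) = inj₁ (∈-lift⁻ ab∈G′)
  Adj-lift⁻ (inj₂ ba∈G′) = inj₂ (∈-lift⁻ ba∈G′)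

  Adj-new⁻ : ∀ {y} → Adj G′ new y → y ≡ inject₁ v
  Adj-new⁻ (inj₁ e∈G′) with ∈-++⁻ (map liftEdge (edges G)) e∈G′
  ... | inj₁ e∈L′ = contradiction e∈L′ fromℕ-src∉map-liftEdge
  ... | inj₂ (here eq) = contradiction (cong proj₁ eq) fromℕ≢inject₁
  Adj-new⁻ (inj₂ e∈G′) with ∈-++⁻ (map liftEdge (edges G)) e∈G′
  ... | inj₁ e∈L′ = contradiction e∈L′ fromℕ-tgt∉map-liftEdge
  ... | inj₂ (here eq) = cong proj₁ eq

  new-AdjOnlyTo : AdjOnlyTo G′ new (inject₁ v)
  new-AdjOnlyTo = Adj-new⁻ , fromℕ≢inject₁

  AdjOnlyTo-lift : ∀ {u} → AdjOnlyTo G u v → AdjOnlyTo G′ (inject₁ u) (inject₁ v)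
  AdjOnlyTo-lift {u} (only , u≢v) = only′ , u≢v ∘ inject₁-injective
    where
    only′ : ∀ {x} → Adj G′ (inject₁ u) x → x ≡ inject₁ v
    only′ {x} u~x with view x
    ... | ‵fromℕ = contradiction (Adj-new⁻ (Adj-sym G′ u~x)) (u≢v ∘ inject₁-injective)
    ... | ‵inject₁ b = cong inject₁ (only (Adj-lift⁻ u~x))

  DTPair-addPendant : ∀ {D T} → DTPair G D T → v ∈ T → DTPair G′ (D Vec.∷ʳ true) (T Vec.∷ʳ false)
  DTPair-addPendant {D} {T} (dis , dom , td) v∈T = dis′ , dom′ , td′
    where
    dis′ : Disjoint (D Vec.∷ʳ true) (T Vec.∷ʳ false)
    dis′ x x∈D′ x∈T′ with view x
    ... | ‵fromℕ = contradiction ([]=-injective (∷ʳ-[]=-fromℕ T) x∈T′) λ ()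
    ... | ‵inject₁ i = dis i (∷ʳ-[]=⁻ D x∈D′) (∷ʳ-[]=⁻ T x∈T′)
    dom′ : Dominating G′ (D Vec.∷ʳ true)
    dom′ x x∉D′ with view x
    ... | ‵fromℕ = contradiction (∷ʳ-[]=-fromℕ D) x∉D′
    ... | ‵inject₁ i with y , y∈D , i~y ← dom i (x∉D′ ∘ ∷ʳ-[]=⁺) =
      inject₁ y , ∷ʳ-[]=⁺ y∈D , Adj-lift⁺ i~y
    td′ : TotalDominating G′ (T Vec.∷ʳ false)
    td′ x with view x
    ... | ‵fromℕ = inject₁ v , ∷ʳ-[]=⁺ v∈T , Adj-sym G′ Adj-pendant
    ... | ‵inject₁ i with y , y∈T , i~y ← td i = inject₁ y , ∷ʳ-[]=⁺ y∈T , Adj-lift⁺ i~y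

  DTPair-removePendant : ∀ {u D T d t} → AdjOnlyTo G u v →
    DTPair G′ (D Vec.∷ʳ d) (T Vec.∷ʳ t) → DTPair G D T
  DTPair-removePendant {u} {D} {T} {d} only pair′@(dis′ , dom′ , td′) = dis , dom , td
    where
    new∈D′ : new ∈ D Vec.∷ʳ d
    new∈D′ = AdjOnlyTo⇒∈D new-AdjOnlyTo pair′
    u∈D : u ∈ D
    u∈D = ∷ʳ-[]=⁻ D (AdjOnlyTo⇒∈D (AdjOnlyTo-lift only) pair′)
    u~v : Adj G u v
    u~v = Adj-lift⁻ (proj₂ (AdjOnlyTo⇒dominated (AdjOnlyTo-lift only) td′))
    dis : Disjoint D T
    dis i i∈D i∈T = dis′ (inject₁ i) (∷ʳ-[]=⁺ i∈D) (∷ʳ-[]=⁺ i∈T)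
    dom : Dominating G D
    dom w w∉D with x , x∈D′ , w~x ← dom′ (inject₁ w) (w∉D ∘ ∷ʳ-[]=⁻ D) with view x
    ... | ‵fromℕ with refl ← inject₁-injective (Adj-new⁻ (Adj-sym G′ w~x)) =
      u , u∈D , Adj-sym G u~v
    ... | ‵inject₁ b = b , ∷ʳ-[]=⁻ D x∈D′ , Adj-lift⁻ w~x
    td : TotalDominating G T
    td w with x , x∈T′ , w~x ← td′ (inject₁ w) with view x
    ... | ‵fromℕ = contradiction x∈T′ (dis′ new new∈D′)
    ... | ‵inject₁ b = b , ∷ʳ-[]=⁻ T x∈T′ , Adj-lift⁻ w~x

  DTDP-addPendant : ∀ {u} → AdjOnlyTo G u v → DTDP G → DTDP G′
  DTDP-addPendant only (D , T , pair@(_ , _ , td)) =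
    D Vec.∷ʳ true , T Vec.∷ʳ false , DTPair-addPendant pair (proj₁ (AdjOnlyTo⇒dominated only td))

  DTDP-removePendant : ∀ {u} → AdjOnlyTo G u v → DTDP G′ → DTDP G
  DTDP-removePendant only (D′ , T′ , pair′) with initLast D′ | initLast T′
  ... | D , _ , refl | T , _ , refl = D , T , DTPair-removePendant only pair′

  Connected-addPendant : Connected G → Connected G′
  Connected-addPendant conn x y = to-v x ◅◅ reverse (Adj-sym G′) (to-v y)
    where
    to-v : ∀ x → Star (Adj G′) x (inject₁ v)
    to-v x with view x
    ... | ‵fromℕ = Adj-sym G′ Adj-pendant ◅ ε
    ... | ‵inject₁ i = gmap inject₁ Adj-lift⁺ (conn i v)

  collapse : Fin (suc n) → Fin n
  collapse x with view x
  ... | ‵fromℕ = v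
  ... | ‵inject₁ i = i

  collapse-inject₁ : ∀ i → collapse (inject₁ i) ≡ i
  collapse-inject₁ i rewrite view-inject₁ i = refl

  collapse-Adj : ∀ {x y} → Adj G′ x y → Star (Adj G) (collapse x) (collapse y)
  collapse-Adj {x} {y} x~y with view x | view y
  ... | ‵fromℕ | ‵fromℕ = ε
  ... | ‵fromℕ | ‵inject₁ b = reflexive (Adj G) (sym (inject₁-injective (Adj-new⁻ x~y)))
  ... | ‵inject₁ a | ‵fromℕ = reflexive (Adj G) (inject₁-injective (Adj-new⁻ (Adj-sym G′ x~y)))
  ... | ‵inject₁ a | ‵inject₁ b = Adj-lift⁻ x~y ◅ ε

  Connected-removePendant : Connected G′ → Connected G
  Connected-removePendant conn′ a b =
    subst₂ (Star (Adj G)) (collapse-inject₁ a) (collapse-inject₁ b)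
      (kleisliStar collapse collapse-Adj (conn′ (inject₁ a) (inject₁ b)))

  ProperSpanning-addPendant⁻ : ∀ {H} → ProperSpanning H G′ →
    edges H ⊆ map liftEdge (edges G) ⊎ ∃[ H₀ ] (ProperSpanning H₀ G × H ≡ addPendant H₀ v)
  ProperSpanning-addPendant⁻ (H⊆G′ , shorter) with ⊆-++-[]⁻ (map liftEdge (edges G)) H⊆G′
  ... | inj₁ H⊆lifted = inj₁ H⊆lifted
  ... | inj₂ (zs , zs⊆ , eq) with S , S⊆G , refl ← ⊆-map⁻ liftEdge zs⊆ =
    inj₂ (mkGraph S , (S⊆G , s<s⁻¹ shorter′) , cong mkGraph eq)
    where
    shorter′ : suc (length S) < suc (length (edges G))
    shorter′ = subst₂ _<_ (trans (cong length eq) (length-addPendant (mkGraph S) v))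
                          (length-addPendant G v) shorter

  new-isolated : ∀ {H} → edges H ⊆ map liftEdge (edges G) → ∀ {y} → ¬ Adj H new y
  new-isolated H⊆lifted new~y with Adj-⊆ {G = mkGraph (map liftEdge (edges G))} H⊆lifted new~y
  ... | inj₁ e∈L′ = fromℕ-src∉map-liftEdge e∈L′
  ... | inj₂ e∈L′ = fromℕ-tgt∉map-liftEdge e∈L′

open Pendant

MinimalDTDP-addPendant : ∀ {n} {G : Graph n} {u v} → AdjOnlyTo G u v →
  MinimalDTDP G → MinimalDTDP (addPendant G v)
MinimalDTDP-addPendant {n} {G} {v = v} only (conn , dtdp , minimal) =
  Connected-addPendant G v conn , DTDP-addPendant G v only dtdp , no-proper
  where
  no-proper : ∀ H → ProperSpanning H (addPendant G v) → ¬ DTDP H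
  no-proper H H<G′ dtdpH@(_ , _ , _ , _ , td) with ProperSpanning-addPendant⁻ G v H<G′
  ... | inj₁ H⊆lifted = new-isolated G v H⊆lifted (proj₂ (proj₂ (td (fromℕ n))))
  ... | inj₂ (H₀ , H₀<G@(H₀⊆G , _) , refl) =
    minimal H₀ H₀<G (DTDP-removePendant H₀ v (AdjOnlyTo-⊆ H₀⊆G only) dtdpH)

MinimalDTDP-removePendant : ∀ {n} {G : Graph n} {u v} → AdjOnlyTo G u v →
  MinimalDTDP (addPendant G v) → MinimalDTDP G
MinimalDTDP-removePendant {G = G} {v = v} only (conn′ , dtdp′ , minimal′) =
  Connected-removePendant G v conn′ , DTDP-removePendant G v only dtdp′ , no-proper
  where
  no-proper : ∀ H → ProperSpanning H G → ¬ DTDP H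
  no-proper H H<G@(H⊆G , _) dtdpH =
    minimal′ (addPendant H v) (ProperSpanning-addPendant v H<G)
      (DTDP-addPendant H v (AdjOnlyTo-⊆ H⊆G only) dtdpH)

mainTheorem2 : (n : ℕ) (G : Graph n) (v : Fin n) → Support G v →
    (DTDP G ⇔ DTDP (addPendant G v)) × (MinimalDTDP G ⇔ MinimalDTDP (addPendant G v))
mainTheorem2 n G v support with u , only ← Support⇒AdjOnlyTo G support =
  mk⇔ (DTDP-addPendant G v only) (DTDP-removePendant G v only) ,
  mk⇔ (MinimalDTDP-addPendant only) (MinimalDTDP-removePendant only)
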